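{- Let $d, m^*, n^*, q$ be positive integers with $\gcd(d, m^*) = \gcd(d, n^*) = 1$ and $n^* \mid m^*$, and set $m = d m^*$ and $n = d^q n^*$. Then for every integer $c$, the congruence $$x_0 + d x_1 + \cdots + d^{q-1} x_{q-1} \equiv c \pmod{n}$$ in the $q$ variables $x_0, \dots, x_{q-1}$ has exactly $\frac{(m^*)^q}{n^*}$ integer solutions satisfying $0 \leq x_i < m$ for all $0 \leq i < q$. -}

module Defs where

open import Data.Nat as ℕ using (ℕ; zero; suc)
import Data.Nat.Divisibility as ℕD
open import Data.Integer as ℤ using (ℤ; +_; ∣_∣)
open import Data.Integer.Divisibility using (_∣_)
open import Data.Fin using (Fin; toℕ)
open import Data.Vec using (Vec; []; _∷_)
open import Data.List using (List; []; _∷_; allFin; map; concatMap; filter; length)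
open import Relation.Nullary using (Dec)

allVecs : (m q : ℕ) → List (Vec (Fin m) q)
allVecs m zero = [] ∷ []
allVecs m (suc q) = concatMap (λ x → map (x ∷_) (allVecs m q)) (allFin m)

-- x₀ + d x₁ + ⋯ + d^{q-1} x_{q-1}, computed as an integer (Horner form:
-- x₀ + d (x₁ + d (x₂ + ⋯))).
weightedSum : (d : ℕ) {m q : ℕ} → Vec (Fin m) q → ℤ
weightedSum d [] = + 0
weightedSum d (x ∷ xs) = + toℕ x ℤ.+ (+ d) ℤ.* weightedSum d xs

Solves : (d n : ℕ) (c : ℤ) {m q : ℕ} → Vec (Fin m) q → Set
Solves d n c x = (+ n) ∣ (weightedSum d x ℤ.- c)

solves? : (d n : ℕ) (c : ℤ) {m q : ℕ} (x : Vec (Fin m) q) → Dec (Solves d n c x)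
solves? d n c x = n ℕD.∣? ∣ weightedSum d x ℤ.- c ∣

numSolutions : (d m n q : ℕ) (c : ℤ) → ℕ
numSolutions d m n q c = length (filter (solves? d n c) (allVecs m q))

-- Fix the first coordinate x₀. Modulo d·M the congruence forces x₀ ≡ c (mod d), and for such
-- x₀ it is equivalent to x₁ + d x₂ + ⋯ ≡ (c − x₀)/d (mod M) in the remaining coordinates.
-- Exactly m* of the values 0 ≤ x₀ < d m* satisfy x₀ ≡ c (mod d), so if the number of solutions
-- of the shorter congruence does not depend on c, adding a variable multiplies it by m*.
-- For one variable and modulus d n*, the range 0 ≤ x₀ < d m* consists of m*/n* complete
-- residue systems modulo d n*, giving m*/n* solutions; by induction there are m*^{q-1}·m*/n*.
module Submission where

open import Defs
open import Data.Nat using (ℕ; _*_; _^_; _/_; NonZero)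
open import Data.Nat.Divisibility using (_∣_)
open import Data.Nat.GCD using (gcd)
open import Data.Integer using (ℤ)
open import Relation.Binary.PropositionalEquality using (_≡_)

open import Data.Bool using (true; false)
open import Data.Empty using (⊥-elim)
open import Data.Fin using (Fin; toℕ)
open import Data.Integer as ℤ using (+_; ∣_∣; _⊖_)
open import Data.Integer.DivMod using (_%ℕ_; _/ℕ_; n%ℕd<d; a≡a%ℕn+[a/ℕn]*n)
import Data.Integer.Divisibility.Signed as Signed
open import Data.Integer.Divisibility.Signed using (divides)
import Data.Integer.Properties as ℤ
open import Data.Integer.Tactic.RingSolver using (solve-∀)
open import Data.List using (List; []; _∷_; _++_; map; concatMap; filter; length; allFin; tabulate)
open import Data.List.Properties
  using (length-++; filter-++; filter-accept; filter-reject; filter-none; filter-≐; map-cong; map-tabulate)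
open import Data.List.Relation.Unary.All using (universal)
open import Data.Nat.Base as ℕ using (zero; suc; _+_; _<_; _%_; z<s; s<s; ≢-nonZero⁻¹)
open import Data.Nat.DivMod using (m<n⇒m%n≡m; [m+n]%n≡m%n; m/n*n≡m; *-/-assoc)
open import Data.Nat.Divisibility using (_∣?_; ∣-trans; m∣m*n; *-cancelˡ-∣; *-monoʳ-∣; n∣m⇒m%n≡0)
open import Data.Nat.ListAction using (sum)
open import Data.Nat.Properties
  using (*-comm; *-assoc; *-identityʳ; +-comm; +-identityʳ; +-assoc; suc-injective; m*n≢0;
         ⊔-pres-<m; ∣m-n∣≤m⊔n; ∣m-n∣≡0⇒m≡n; ≤-<-trans)
open import Data.Product using (_,_)
open import Data.Vec using (Vec; []; _∷_)
open import Function using (_∘_; _⇔_; mk⇔; Equivalence)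
open import Level using (Level)
open import Relation.Binary.PropositionalEquality
  using (_≢_; refl; sym; trans; cong; cong₂; subst; module ≡-Reasoning)
open import Relation.Nullary using (does)
open import Relation.Unary using (Pred; Decidable; _≐_)
open ≡-Reasoning

private
  variable
    a b p : Level
    A : Set a
    B : Set b


∣m⊖n∣≡∣m-n∣ : ∀ m n → ∣ m ⊖ n ∣ ≡ ℕ.∣ m - n ∣
∣m⊖n∣≡∣m-n∣ zero    zero    = refl
∣m⊖n∣≡∣m-n∣ zero    (suc n) = refl
∣m⊖n∣≡∣m-n∣ (suc m) zero    = refl
∣m⊖n∣≡∣m-n∣ (suc m) (suc n) = trans (cong ∣_∣ (ℤ.[1+m]⊖[1+n]≡m⊖n m n)) (∣m⊖n∣≡∣m-n∣ m n)

m∣n∧n<m⇒n≡0 : ∀ {m n} .{{_ : NonZero m}} → m ∣ n → n < m → n ≡ 0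
m∣n∧n<m⇒n≡0 {m} {n} m∣n n<m = trans (sym (m<n⇒m%n≡m n<m)) (n∣m⇒m%n≡0 n m m∣n)

m<k∧n<k∧k∣m-n⇒m≡n : ∀ {k m n} .{{_ : NonZero k}} → m < k → n < k → + k Signed.∣ + m ℤ.- + n → m ≡ n
m<k∧n<k∧k∣m-n⇒m≡n {k} {m} {n} m<k n<k k∣m-n =
  ∣m-n∣≡0⇒m≡n (m∣n∧n<m⇒n≡0 k∣∣m-n∣ (≤-<-trans (∣m-n∣≤m⊔n m n) (⊔-pres-<m m<k n<k)))
  where
  k∣∣m-n∣ : k ∣ ℕ.∣ m - n ∣
  k∣∣m-n∣ = subst (k ∣_) (trans (cong ∣_∣ (ℤ.m-n≡m⊖n m n)) (∣m⊖n∣≡∣m-n∣ m n)) (Signed.∣⇒∣ᵤ k∣m-n)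

i%ℕk≡j%ℕk⇔k∣i-j : ∀ i j k .{{_ : NonZero k}} → (i %ℕ k ≡ j %ℕ k) ⇔ (+ k Signed.∣ i ℤ.- j)
i%ℕk≡j%ℕk⇔k∣i-j i j k = mk⇔ same⇒∣ ∣⇒same
  where
  r s : ℤ
  r = + (i %ℕ k)
  s = + (j %ℕ k)
  t : ℤ
  t = i /ℕ k ℤ.- j /ℕ k

  i-j≡r-s+t*k : i ℤ.- j ≡ (r ℤ.- s) ℤ.+ t ℤ.* + k
  i-j≡r-s+t*k = trans (cong₂ ℤ._-_ (a≡a%ℕn+[a/ℕn]*n i k) (a≡a%ℕn+[a/ℕn]*n j k))
                      (regroup r s (i /ℕ k) (j /ℕ k) (+ k))
    where
    regroup : ∀ r s a b k → (r ℤ.+ a ℤ.* k) ℤ.- (s ℤ.+ b ℤ.* k) ≡ (r ℤ.- s) ℤ.+ (a ℤ.- b) ℤ.* k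
    regroup = solve-∀

  same⇒∣ : i %ℕ k ≡ j %ℕ k → + k Signed.∣ i ℤ.- j
  same⇒∣ eq = divides t (begin
    i ℤ.- j                   ≡⟨ i-j≡r-s+t*k ⟩
    (r ℤ.- s) ℤ.+ t ℤ.* + k   ≡⟨ cong (λ u → (u ℤ.- s) ℤ.+ t ℤ.* + k) (cong +_ eq) ⟩
    (s ℤ.- s) ℤ.+ t ℤ.* + k   ≡⟨ cong (ℤ._+ t ℤ.* + k) (ℤ.+-inverseʳ s) ⟩
    + 0 ℤ.+ t ℤ.* + k         ≡⟨ ℤ.+-identityˡ (t ℤ.* + k) ⟩
    t ℤ.* + k                 ∎)

  ∣⇒same : + k Signed.∣ i ℤ.- j → i %ℕ k ≡ j %ℕ k
  ∣⇒same k∣i-j = m<k∧n<k∧k∣m-n⇒m≡n (n%ℕd<d i k) (n%ℕd<d j k)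
    (Signed.∣m+n∣n⇒∣m (subst (+ k Signed.∣_) i-j≡r-s+t*k k∣i-j) (Signed.∣n⇒∣m*n t Signed.∣-refl))

∑< : ℕ → (ℕ → ℕ) → ℕ
∑< zero    f = 0
∑< (suc n) f = f 0 + ∑< n (f ∘ suc)

∑<-+ : ∀ m n (f : ℕ → ℕ) → ∑< (m + n) f ≡ ∑< m f + ∑< n (λ x → f (m + x))
∑<-+ zero    n f = refl
∑<-+ (suc m) n f = trans (cong (_+_ (f 0)) (∑<-+ m n (f ∘ suc))) (sym (+-assoc (f 0) _ _))

∑<-zero : ∀ n (f : ℕ → ℕ) → (∀ x → x < n → f x ≡ 0) → ∑< n f ≡ 0
∑<-zero zero    f _   = refl
∑<-zero (suc n) f f≡0 = cong₂ _+_ (f≡0 0 z<s) (∑<-zero n (f ∘ suc) (λ x x<n → f≡0 (suc x) (s<s x<n)))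

∑<-single : ∀ n (f : ℕ → ℕ) {r} → r < n → (∀ x → x < n → x ≢ r → f x ≡ 0) → ∑< n f ≡ f r
∑<-single (suc n) f {zero} _ off =
  trans (cong (_+_ (f 0)) (∑<-zero n (f ∘ suc) (λ x x<n → off (suc x) (s<s x<n) λ ()))) (+-identityʳ (f 0))
∑<-single (suc n) f {suc r} (s<s r<n) off =
  cong₂ _+_ (off 0 z<s λ ()) (∑<-single n (f ∘ suc) r<n (λ x x<n x≢r → off (suc x) (s<s x<n) (x≢r ∘ suc-injective)))

∑<-residue : ∀ L {k r V} .{{_ : NonZero k}} (f : ℕ → ℕ) → r < k
           → (∀ x → x % k ≡ r → f x ≡ V) → (∀ x → x % k ≢ r → f x ≡ 0)
           → ∑< (L * k) f ≡ L * V
∑<-residue zero    f r<k on off = refl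
∑<-residue (suc L) {k} {r} {V} f r<k on off = begin
  ∑< (k + L * k) f                        ≡⟨ ∑<-+ k (L * k) f ⟩
  ∑< k f + ∑< (L * k) (λ x → f (k + x))   ≡⟨ cong₂ _+_ firstBlock otherBlocks ⟩
  V + L * V                               ∎
  where
  shift : ∀ x → (k + x) % k ≡ x % k
  shift x = trans (cong (_% k) (+-comm k x)) ([m+n]%n≡m%n x k)

  firstBlock : ∑< k f ≡ V
  firstBlock = trans (∑<-single k f r<k (λ x x<k x≢r → off x (x≢r ∘ trans (sym (m<n⇒m%n≡m x<k)))))
                     (on r (m<n⇒m%n≡m r<k))

  otherBlocks : ∑< (L * k) (λ x → f (k + x)) ≡ L * V
  otherBlocks = ∑<-residue L (λ x → f (k + x)) r<k
    (λ x x%k≡r → on (k + x) (trans (shift x) x%k≡r))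
    (λ x x%k≢r → off (k + x) (x%k≢r ∘ trans (sym (shift x))))

sum-tabulate : ∀ n (f : ℕ → ℕ) → sum (tabulate {n = n} (f ∘ toℕ)) ≡ ∑< n f
sum-tabulate zero    f = refl
sum-tabulate (suc n) f = cong (_+_ (f 0)) (sum-tabulate n (f ∘ suc))

sum-map-allFin : ∀ n (f : ℕ → ℕ) → sum (map (f ∘ toℕ) (allFin n)) ≡ ∑< n f
sum-map-allFin n f = trans (cong sum (map-tabulate {n = n} (λ i → i) (f ∘ toℕ))) (sum-tabulate n f)

length-filter-map : {P : Pred B p} (P? : Decidable P) (f : A → B) (xs : List A)
                  → length (filter P? (map f xs)) ≡ length (filter (P? ∘ f) xs)
length-filter-map P? f []       = refl
length-filter-map P? f (x ∷ xs) with does (P? (f x))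
... | true  = cong suc (length-filter-map P? f xs)
... | false = length-filter-map P? f xs

length-filter-concatMap : {P : Pred B p} (P? : Decidable P) (f : A → List B) (xs : List A)
                        → length (filter P? (concatMap f xs)) ≡ sum (map (λ x → length (filter P? (f x))) xs)
length-filter-concatMap P? f []       = refl
length-filter-concatMap P? f (x ∷ xs) = begin
  length (filter P? (f x ++ concatMap f xs))                  ≡⟨ cong length (filter-++ P? (f x) (concatMap f xs)) ⟩
  length (filter P? (f x) ++ filter P? (concatMap f xs))      ≡⟨ length-++ (filter P? (f x)) ⟩
  length (filter P? (f x)) + length (filter P? (concatMap f xs))
    ≡⟨ cong (_+_ (length (filter P? (f x)))) (length-filter-concatMap P? f xs) ⟩
  length (filter P? (f x)) + sum (map (λ y → length (filter P? (f y))) xs) ∎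

-- Solves d N c (i ∷ xs) is definitionally SolvesCons d N c (toℕ i) xs; taking the head as a
-- natural number lets the count of tails be summed with ∑<.
SolvesCons : (d N : ℕ) (c : ℤ) (x : ℕ) {m q : ℕ} → Vec (Fin m) q → Set
SolvesCons d N c x xs = N ∣ ∣ + x ℤ.+ + d ℤ.* weightedSum d xs ℤ.- c ∣

solvesCons? : (d N : ℕ) (c : ℤ) (x : ℕ) {m q : ℕ} → Decidable (SolvesCons d N c x {m} {q})
solvesCons? d N c x xs = N ∣? ∣ + x ℤ.+ + d ℤ.* weightedSum d xs ℤ.- c ∣

tailCount : (d m N q : ℕ) (c : ℤ) → ℕ → ℕ
tailCount d m N q c x = length (filter (solvesCons? d N c x) (allVecs m q))

numSolutions-suc : ∀ d m N q c → numSolutions d m N (suc q) c ≡ ∑< m (tailCount d m N q c)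
numSolutions-suc d m N q c = begin
  length (filter (solves? d N c) (concatMap (λ i → map (i ∷_) (allVecs m q)) (allFin m)))
    ≡⟨ length-filter-concatMap (solves? d N c) (λ i → map (i ∷_) (allVecs m q)) (allFin m) ⟩
  sum (map (λ i → length (filter (solves? d N c) (map (i ∷_) (allVecs m q)))) (allFin m))
    ≡⟨ cong sum (map-cong (λ i → length-filter-map (solves? d N c) (i ∷_) (allVecs m q)) (allFin m)) ⟩
  sum (map (tailCount d m N q c ∘ toℕ) (allFin m))
    ≡⟨ sum-map-allFin m (tailCount d m N q c) ⟩
  ∑< m (tailCount d m N q c) ∎

numSolutions-by-residue : ∀ {d m N q c} L {k r V} .{{_ : NonZero k}} → m ≡ L * k → r < k
  → (∀ x → x % k ≡ r → tailCount d m N q c x ≡ V)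
  → (∀ x → x % k ≢ r → tailCount d m N q c x ≡ 0)
  → numSolutions d m N (suc q) c ≡ L * V
numSolutions-by-residue {d} {m} {N} {q} {c} L {k} {V = V} m≡L*k r<k on off = begin
  numSolutions d m N (suc q) c        ≡⟨ numSolutions-suc d m N q c ⟩
  ∑< m (tailCount d m N q c)          ≡⟨ cong (λ n → ∑< n (tailCount d m N q c)) m≡L*k ⟩
  ∑< (L * k) (tailCount d m N q c)    ≡⟨ ∑<-residue L (tailCount d m N q c) r<k on off ⟩
  L * V                               ∎

solvesCons-[]⇔ : ∀ d N c x {m} .{{_ : NonZero N}} → SolvesCons d N c x ([] {A = Fin m}) ⇔ (x % N ≡ c %ℕ N)
solvesCons-[]⇔ d N c x = mk⇔
  (λ h → Equivalence.from (i%ℕk≡j%ℕk⇔k∣i-j (+ x) c N)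
           (Signed.∣ᵤ⇒∣ {+ N} {+ x ℤ.- c} (subst (λ z → N ∣ ∣ z ∣) lhs≡ h)))
  (λ e → subst (λ z → N ∣ ∣ z ∣) (sym lhs≡)
           (Signed.∣⇒∣ᵤ (Equivalence.to (i%ℕk≡j%ℕk⇔k∣i-j (+ x) c N) e)))
  where
  lhs≡ : + x ℤ.+ + d ℤ.* + 0 ℤ.- c ≡ + x ℤ.- c
  lhs≡ = cong (ℤ._- c) (trans (cong (ℤ._+_ (+ x)) (ℤ.*-zeroʳ (+ d))) (ℤ.+-identityʳ (+ x)))

solvesCons-shift : ∀ {d M c c′ x m q} .{{_ : NonZero d}} → c ℤ.- + x ≡ c′ ℤ.* + d
                 → SolvesCons d (d * M) c x ≐ Solves d M c′ {m} {q}
solvesCons-shift {d} {M} {c} {c′} {x} c-x≡c′*d =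
  (λ {xs} h → *-cancelˡ-∣ d (subst (d * M ∣_) (∣lhs∣ xs) h)) ,
  (λ {xs} h → subst (d * M ∣_) (sym (∣lhs∣ xs)) (*-monoʳ-∣ d h))
  where
  lhs≡ : ∀ w → + x ℤ.+ + d ℤ.* w ℤ.- c ≡ + d ℤ.* (w ℤ.- c′)
  lhs≡ w = begin
    + x ℤ.+ + d ℤ.* w ℤ.- c     ≡⟨ move (+ x) (+ d) w c ⟩
    + d ℤ.* w ℤ.- (c ℤ.- + x)   ≡⟨ cong (λ u → + d ℤ.* w ℤ.- u) c-x≡c′*d ⟩
    + d ℤ.* w ℤ.- c′ ℤ.* + d    ≡⟨ factor (+ d) w c′ ⟩
    + d ℤ.* (w ℤ.- c′)          ∎
    where
    move : ∀ x d w c → x ℤ.+ d ℤ.* w ℤ.- c ≡ d ℤ.* w ℤ.- (c ℤ.- x)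
    move = solve-∀
    factor : ∀ d w c′ → d ℤ.* w ℤ.- c′ ℤ.* d ≡ d ℤ.* (w ℤ.- c′)
    factor = solve-∀

  ∣lhs∣ : ∀ {m q} (xs : Vec (Fin m) q)
        → ∣ + x ℤ.+ + d ℤ.* weightedSum d xs ℤ.- c ∣ ≡ d * ∣ weightedSum d xs ℤ.- c′ ∣
  ∣lhs∣ xs = trans (cong ∣_∣ (lhs≡ (weightedSum d xs))) (ℤ.abs-* (+ d) _)

solvesCons⇒%≡ : ∀ {d M c x m q} .{{_ : NonZero d}} {xs : Vec (Fin m) q}
              → SolvesCons d (d * M) c x xs → x % d ≡ c %ℕ d
solvesCons⇒%≡ {d} {M} {c} {x} {xs = xs} h =
  Equivalence.from (i%ℕk≡j%ℕk⇔k∣i-j (+ x) c d)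
    (subst (+ d Signed.∣_) (cancel (+ x) (+ d) w c) (Signed.∣m∣n⇒∣m-n d∣lhs (Signed.∣m⇒∣m*n w Signed.∣-refl)))
  where
  w : ℤ
  w = weightedSum d xs
  d∣lhs : + d Signed.∣ + x ℤ.+ + d ℤ.* w ℤ.- c
  d∣lhs = Signed.∣ᵤ⇒∣ {+ d} {+ x ℤ.+ + d ℤ.* w ℤ.- c} (∣-trans (m∣m*n M) h)
  cancel : ∀ x d w c → x ℤ.+ d ℤ.* w ℤ.- c ℤ.- d ℤ.* w ≡ x ℤ.- c
  cancel = solve-∀

numSolutions-one : ∀ d {m} k L c .{{_ : NonZero k}} → m ≡ L * k → numSolutions d m k 1 c ≡ L
numSolutions-one d {m} k L c m≡L*k =
  trans (numSolutions-by-residue L m≡L*k (n%ℕd<d c k) on off) (*-identityʳ L)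
  where
  on : ∀ x → x % k ≡ c %ℕ k → tailCount d m k 0 c x ≡ 1
  on x e = cong length
    (filter-accept (solvesCons? d k c x) (Equivalence.from (solvesCons-[]⇔ d k c x {m}) e))
  off : ∀ x → x % k ≢ c %ℕ k → tailCount d m k 0 c x ≡ 0
  off x ne = cong length
    (filter-reject (solvesCons? d k c x) (ne ∘ Equivalence.to (solvesCons-[]⇔ d k c x {m})))

numSolutions-step : ∀ d m* M q V .{{_ : NonZero d}} → (∀ c → numSolutions d (d * m*) M q c ≡ V)
                  → ∀ c → numSolutions d (d * m*) (d * M) (suc q) c ≡ m* * V
numSolutions-step d m* M q V count c = numSolutions-by-residue m* (*-comm d m*) (n%ℕd<d c d) on off
  where
  on : ∀ x → x % d ≡ c %ℕ d → tailCount d (d * m*) (d * M) q c x ≡ V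
  on x e with Equivalence.to (i%ℕk≡j%ℕk⇔k∣i-j c (+ x) d) (sym e)
  ... | divides c′ c-x≡c′*d = trans
    (cong length (filter-≐ (solvesCons? d (d * M) c x) (solves? d M c′)
                           (solvesCons-shift c-x≡c′*d) (allVecs (d * m*) q)))
    (count c′)
  off : ∀ x → x % d ≢ c %ℕ d → tailCount d (d * m*) (d * M) q c x ≡ 0
  off x ne = cong length (filter-none (solvesCons? d (d * M) c x)
    (universal (λ xs → ne ∘ solvesCons⇒%≡ {M = M} {xs = xs}) (allVecs (d * m*) q)))

numSolutions-pow : ∀ d m* n* .{{_ : NonZero d}} .{{_ : NonZero n*}} → n* ∣ m*
                 → ∀ q c → numSolutions d (d * m*) (d ^ suc q * n*) (suc q) c ≡ m* ^ suc q / n*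
numSolutions-pow d m* n* n*∣m* zero c = begin
  numSolutions d (d * m*) (d * 1 * n*) 1 c   ≡⟨ cong (λ N → numSolutions d (d * m*) N 1 c) (cong (_* n*) (*-identityʳ d)) ⟩
  numSolutions d (d * m*) (d * n*) 1 c       ≡⟨ numSolutions-one d (d * n*) (m* / n*) c {{m*n≢0 d n*}} d*m*≡[m*/n*]*[d*n*] ⟩
  m* / n*                                    ≡⟨ cong (_/ n*) (*-identityʳ m*) ⟨
  m* * 1 / n*                                ∎
  where
  d*m*≡[m*/n*]*[d*n*] : d * m* ≡ m* / n* * (d * n*)
  d*m*≡[m*/n*]*[d*n*] = begin
    d * m*                ≡⟨ cong (d *_) (m/n*n≡m n*∣m*) ⟨
    d * (m* / n* * n*)    ≡⟨ cong (d *_) (*-comm (m* / n*) n*) ⟩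
    d * (n* * (m* / n*))  ≡⟨ *-assoc d n* (m* / n*) ⟨
    d * n* * (m* / n*)    ≡⟨ *-comm (d * n*) (m* / n*) ⟩
    m* / n* * (d * n*)    ∎
numSolutions-pow d m* n* n*∣m* (suc q) c = begin
  numSolutions d (d * m*) (d * d ^ suc q * n*) (suc (suc q)) c
    ≡⟨ cong (λ N → numSolutions d (d * m*) N (suc (suc q)) c) (*-assoc d (d ^ suc q) n*) ⟩
  numSolutions d (d * m*) (d * (d ^ suc q * n*)) (suc (suc q)) c
    ≡⟨ numSolutions-step d m* (d ^ suc q * n*) (suc q) _ (numSolutions-pow d m* n* n*∣m* q) c ⟩
  m* * (m* ^ suc q / n*)
    ≡⟨ *-/-assoc m* (∣-trans n*∣m* (m∣m*n (m* ^ q))) ⟨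
  m* ^ suc (suc q) / n* ∎

lemma1 : (d m* n* q : ℕ) → .{{_ : NonZero d}} → .{{_ : NonZero m*}} → .{{nz : NonZero n*}} → .{{_ : NonZero q}}
       → gcd d m* ≡ 1 → gcd d n* ≡ 1 → n* ∣ m*
       → (c : ℤ)
       → numSolutions d (d * m*) (d ^ q * n*) q c ≡ (m* ^ q) / n*
lemma1 d m* n* zero {{_}} {{_}} {{_}} {{q≢0}} _ _ _ _ = ⊥-elim (≢-nonZero⁻¹ zero {{q≢0}} refl)
lemma1 d m* n* (suc q) _ _ n*∣m* c = numSolutions-pow d m* n* n*∣m* q c
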